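{- Let $k,n$ be positive integers and let $[k]_0=\{0,1,\dots,k\}$. Then every subset $X\subset [k]_0^n\subset \mathbb{R}^n_\infty$ with $|X|>k^n$ contains a copy of $\mathcal B_k$, i.e., there are points $\mathbf x^0,\dots,\mathbf x^k\in X$ with $\|\mathbf x^s-\mathbf x^t\|_\infty=|s-t|$ for all $s,t\in[k]_0$.
   Context: $\mathbb{R}^n_\infty$ denotes $\mathbb{R}^n$ with the maximum metric $\|\mathbf x-\mathbf y\|_\infty=\max_i|x_i-y_i|$. $\mathcal B_k$ denotes the metric space $\{0,1,\dots,k\}\subset\mathbb R$ with the metric induced from $\mathbb R$; a copy of it is an isometric image. -}

module Defs where

open import Data.Nat using (ℕ; zero; suc; _⊔_; ∣_-_∣)
open import Data.Fin using (Fin; toℕ)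
open import Data.Vec using (Vec; []; _∷_)

Point : ℕ → ℕ → Set
Point k n = Vec (Fin (suc k)) n

dist∞ : ∀ {k n} → Point k n → Point k n → ℕ
dist∞ []       []       = zero
dist∞ (a ∷ xs) (b ∷ ys) = ∣ toℕ a - toℕ b ∣ ⊔ dist∞ xs ys

-- Induction on n. Cut P ⊆ [k]₀^(n+1) into layers L₀, …, L_k along the first
-- coordinate. Let A₀ = L₀ and let A_{i+1} be the points of L_{i+1} at distance
-- at most 1 from A_i. If A_k is non-empty, walking back down from one of its
-- points gives y₀, …, y_k with y_i ∈ L_i and consecutive distances ≤ 1, so the
-- points (i, y_i) form a copy of B_k. Otherwise put Z_i = (L_{i+1} ∖ A_{i+1}) ∪ A_i
-- for i < k. A copy of B_k in Z_i cannot step between A_i and its complement,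
-- so it lies in L_i or in L_{i+1}; and |Z_i| + |A_{i+1}| = |L_{i+1}| + |A_i|,
-- which telescopes to Σ_i |Z_i| = |P|. By induction, either P contains a copy
-- or |P| ≤ k · k^n.
module Submission where

open import Defs
open import Data.Nat using (ℕ; suc; _^_; _<_; NonZero)
open import Data.Nat as ℕ using (∣_-_∣)
open import Data.Fin using (Fin; toℕ)
open import Data.List using (List; length)
open import Data.List.Relation.Unary.Unique.Propositional using (Unique)
open import Data.List.Membership.Propositional using (_∈_)
open import Data.Product using (Σ; _×_)
open import Relation.Binary.PropositionalEquality using (_≡_)

open import Data.Nat.Properties
open import Algebra.Properties.CommutativeMonoid.Sum +-0-commutativeMonoid
  using (sum-syntax; sum-cong-≗; ∑-distrib-+; sum-replicate-zero)
open import Data.Bool using (Bool; true; false; T; _∧_; _∨_; not)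
open import Data.Bool.Properties using (T-∧; T-∨; T-not-≡)
open import Data.Empty using (⊥-elim)
open import Data.Fin as Fin using (zero; suc; inject₁)
open import Data.Fin.Properties using (any?; toℕ-inject₁; toℕ≤pred[n])
open import Data.List using ([]; _∷_)
open import Data.List.Relation.Unary.All.Properties using (All¬⇒¬Any)
open import Data.List.Relation.Unary.AllPairs using ([]; _∷_)
open import Data.List.Relation.Unary.Any as Any using (here; there)
open import Data.Nat using (zero; _+_; _*_; _∸_; _≤_; _⊔_; _≤?_; z≤n; s≤s)
open import Data.Product using (∃; _,_; proj₁; proj₂)
open import Data.Sum using (_⊎_; inj₁; inj₂; [_,_]′)
open import Data.Vec using ([]; _∷_)
open import Data.Vec.Properties using (≡-dec)
open import Function using (_∘_; Equivalence)
open import Relation.Nullary using (Dec; yes; no; ¬_)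
open import Relation.Nullary.Decidable using (⌊_⌋; toWitness; fromWitness; T?; _×-dec_; map′)
open import Relation.Unary using (Pred; Decidable)
open import Relation.Binary.PropositionalEquality
  using (refl; sym; trans; cong; cong₂; subst; module ≡-Reasoning)

open Equivalence using (to; from)

∃-or-∀ : ∀ {m} {A B : Fin m → Set} → (∀ i → A i ⊎ B i) → ∃ A ⊎ (∀ i → B i)
∃-or-∀ {zero} _ = inj₂ λ ()
∃-or-∀ {suc m} a⊎b with a⊎b zero | ∃-or-∀ (a⊎b ∘ suc)
... | inj₁ a | _            = inj₁ (zero , a)
... | inj₂ _ | inj₁ (i , a) = inj₁ (suc i , a)
... | inj₂ b | inj₂ bs      = inj₂ λ { zero → b ; (suc i) → bs i }

adjacent-equal⇒constant : ∀ {A : Set} {k} (b : Fin (suc k) → A) →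
  (∀ i → b (inject₁ i) ≡ b (suc i)) → ∀ s → b s ≡ b zero
adjacent-equal⇒constant b adj zero = refl
adjacent-equal⇒constant {k = suc k} b adj (suc s) =
  trans (sym (adj s)) (adjacent-equal⇒constant (b ∘ inject₁) (adj ∘ inject₁) s)

T⇔T⇒≡ : ∀ {a b} → (T a → T b) → (T b → T a) → a ≡ b
T⇔T⇒≡ {false} {false} _   _   = refl
T⇔T⇒≡ {false} {true}  _   b⇒a = ⊥-elim (b⇒a _)
T⇔T⇒≡ {true}  {false} a⇒b _   = ⊥-elim (a⇒b _)
T⇔T⇒≡ {true}  {true}  _   _   = refl

∣n-1+n∣≡1 : ∀ n → ∣ n - suc n ∣ ≡ 1
∣n-1+n∣≡1 zero    = refl
∣n-1+n∣≡1 (suc n) = ∣n-1+n∣≡1 n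

∸-step : ∀ m n → m ∸ n ≡ m ∸ suc n ⊎ m ∸ n ≡ suc (m ∸ suc n)
∸-step zero    zero    = inj₁ refl
∸-step (suc m) zero    = inj₂ refl
∸-step zero    (suc n) = inj₁ refl
∸-step (suc m) (suc n) = ∸-step m n

∑-mono-≤ : ∀ {m} {f g : Fin m → ℕ} → (∀ i → f i ≤ g i) → ∑[ i < m ] f i ≤ ∑[ i < m ] g i
∑-mono-≤ {zero}  _   = z≤n
∑-mono-≤ {suc m} f≤g = +-mono-≤ (f≤g zero) (∑-mono-≤ (f≤g ∘ suc))

∑-mono-< : ∀ {m} {f g : Fin m → ℕ} → (∀ i → f i ≤ g i) →
  ∀ j → f j < g j → ∑[ i < m ] f i < ∑[ i < m ] g i
∑-mono-< f≤g zero    fj<gj = +-mono-<-≤ fj<gj (∑-mono-≤ (f≤g ∘ suc))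
∑-mono-< f≤g (suc j) fj<gj = +-mono-≤-< (f≤g zero) (∑-mono-< (f≤g ∘ suc) j fj<gj)

∑-≤-* : ∀ {m b} {f : Fin m → ℕ} → (∀ i → f i ≤ b) → ∑[ i < m ] f i ≤ m * b
∑-≤-* {zero}  _   = z≤n
∑-≤-* {suc m} f≤b = +-mono-≤ (f≤b zero) (∑-≤-* (f≤b ∘ suc))

∑-telescope : ∀ m (z l a : ℕ → ℕ) → (∀ i → z i + a (suc i) ≡ l (suc i) + a i) →
  ∑[ i < m ] z (toℕ i) + a m ≡ a 0 + ∑[ i < m ] l (suc (toℕ i))
∑-telescope zero    z l a _    = sym (+-identityʳ (a 0))
∑-telescope (suc m) z l a step = begin
  z 0 + Σz + a (suc m)    ≡⟨ +-assoc (z 0) Σz _ ⟩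
  z 0 + (Σz + a (suc m))  ≡⟨ cong (z 0 +_) (∑-telescope m (z ∘ suc) (l ∘ suc) (a ∘ suc) (step ∘ suc)) ⟩
  z 0 + (a 1 + Σl)        ≡⟨ +-assoc (z 0) (a 1) Σl ⟨
  z 0 + a 1 + Σl          ≡⟨ cong (_+ Σl) (trans (step 0) (+-comm (l 1) (a 0))) ⟩
  a 0 + l 1 + Σl          ≡⟨ +-assoc (a 0) (l 1) Σl ⟩
  a 0 + (l 1 + Σl)        ∎
  where
  open ≡-Reasoning
  Σz = ∑[ i < m ] z (suc (toℕ i))
  Σl = ∑[ i < m ] l (suc (suc (toℕ i)))

dist∞-self : ∀ {k n} (u : Point k n) → dist∞ u u ≡ 0
dist∞-self []      = refl
dist∞-self (a ∷ u) = cong₂ _⊔_ (∣n-n∣≡0 (toℕ a)) (dist∞-self u)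

dist∞-self≤1 : ∀ {k n} (u : Point k n) → dist∞ u u ≤ 1
dist∞-self≤1 u = subst (_≤ 1) (sym (dist∞-self u)) z≤n

dist∞-sym : ∀ {k n} (u v : Point k n) → dist∞ u v ≡ dist∞ v u
dist∞-sym []      []      = refl
dist∞-sym (a ∷ u) (b ∷ v) = cong₂ _⊔_ (∣-∣-comm (toℕ a) (toℕ b)) (dist∞-sym u v)

dist∞-triangle : ∀ {k n} (u v w : Point k n) → dist∞ u w ≤ dist∞ u v + dist∞ v w
dist∞-triangle []      []      []      = z≤n
dist∞-triangle (a ∷ u) (b ∷ v) (c ∷ w) = ⊔-lub
  (≤-trans (∣-∣-triangle (toℕ a) (toℕ b) (toℕ c))
           (+-mono-≤ (m≤m⊔n ∣ toℕ a - toℕ b ∣ (dist∞ u v)) (m≤m⊔n ∣ toℕ b - toℕ c ∣ (dist∞ v w))))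
  (≤-trans (dist∞-triangle u v w)
           (+-mono-≤ (m≤n⊔m ∣ toℕ a - toℕ b ∣ (dist∞ u v)) (m≤n⊔m ∣ toℕ b - toℕ c ∣ (dist∞ v w))))

UnitSteps : ∀ {k n} → (ℕ → Point k n) → Set
UnitSteps w = ∀ j → dist∞ (w j) (w (suc j)) ≤ 1

unitSteps⇒dist≤∣-∣ : ∀ {k n} (w : ℕ → Point k n) → UnitSteps w →
  ∀ i j → dist∞ (w i) (w j) ≤ ∣ i - j ∣
unitSteps⇒dist≤∣-∣ w steps zero j = from-start j
  where
  open ≤-Reasoning
  from-start : ∀ j → dist∞ (w 0) (w j) ≤ j
  from-start zero    = ≤-reflexive (dist∞-self (w 0))
  from-start (suc j) = begin
    dist∞ (w 0) (w (suc j))                 ≤⟨ dist∞-triangle (w 0) (w j) (w (suc j)) ⟩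
    dist∞ (w 0) (w j) + dist∞ (w j) (w (suc j)) ≤⟨ +-mono-≤ (from-start j) (steps j) ⟩
    j + 1                                   ≡⟨ +-comm j 1 ⟩
    suc j                                   ∎
unitSteps⇒dist≤∣-∣ w steps (suc i) zero =
  subst (_≤ suc i) (dist∞-sym (w 0) (w (suc i))) (unitSteps⇒dist≤∣-∣ w steps zero (suc i))
unitSteps⇒dist≤∣-∣ w steps (suc i) (suc j) = unitSteps⇒dist≤∣-∣ (w ∘ suc) (steps ∘ suc) i j

IsCopy : ∀ {k n} → (Fin (suc k) → Point k n) → Set
IsCopy x = ∀ s t → dist∞ (x s) (x t) ≡ ∣ toℕ s - toℕ t ∣

CopyIn : ∀ {k n} → (Point k n → Bool) → Set
CopyIn {k} {n} P = Σ (Fin (suc k) → Point k n) λ x → (∀ s → T (P (x s))) × IsCopy x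

isCopy-adjacent : ∀ {k n} {x : Fin (suc k) → Point k n} → IsCopy x →
  ∀ i → dist∞ (x (inject₁ i)) (x (suc i)) ≤ 1
isCopy-adjacent {x = x} isCopy i = ≤-reflexive (begin
  dist∞ (x (inject₁ i)) (x (suc i))      ≡⟨ isCopy (inject₁ i) (suc i) ⟩
  ∣ toℕ (inject₁ i) - suc (toℕ i) ∣      ≡⟨ cong (∣_- suc (toℕ i) ∣) (toℕ-inject₁ i) ⟩
  ∣ toℕ i - suc (toℕ i) ∣                ≡⟨ ∣n-1+n∣≡1 (toℕ i) ⟩
  1                                      ∎)
  where open ≡-Reasoning

stack : ∀ {k n} → (ℕ → Point k n) → Fin (suc k) → Point k (suc n)
stack w a = a ∷ w (toℕ a)

stack-isCopy : ∀ {k n} (w : ℕ → Point k n) → UnitSteps w → IsCopy (stack w)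
stack-isCopy w steps s t = m≥n⇒m⊔n≡m (unitSteps⇒dist≤∣-∣ w steps (toℕ s) (toℕ t))

layer : ∀ {k n} → (Point k (suc n) → Bool) → Fin (suc k) → Point k n → Bool
layer P a y = P (a ∷ y)

layer-copy⇒copy : ∀ {k n} (P : Point k (suc n) → Bool) a → CopyIn (layer P a) → CopyIn P
layer-copy⇒copy P a (x , x∈P , isCopy) =
  (λ s → a ∷ x s) , x∈P ,
  λ s t → trans (cong (_⊔ dist∞ (x s) (x t)) (∣n-n∣≡0 (toℕ a))) (isCopy s t)

∃? : ∀ {k n ℓ} {Q : Pred (Point k n) ℓ} → Decidable Q → Dec (∃ Q)
∃? {n = zero}  Q? = map′ ([] ,_) (λ { ([] , q) → q }) (Q? [])
∃? {n = suc n} Q? = map′ (λ (a , y , q) → a ∷ y , q) (λ { (a ∷ y , q) → a , y , q })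
                         (any? λ a → ∃? λ y → Q? (a ∷ y))

gridSum : ∀ {k n} → (Point k n → ℕ) → ℕ
gridSum {n = zero}      f = f []
gridSum {k} {n = suc n} f = ∑[ a < suc k ] gridSum (λ y → f (a ∷ y))

gridSum-cong : ∀ {k n} {f g : Point k n → ℕ} → (∀ p → f p ≡ g p) → gridSum f ≡ gridSum g
gridSum-cong {n = zero}  f≡g = f≡g []
gridSum-cong {n = suc n} f≡g = sum-cong-≗ λ a → gridSum-cong λ y → f≡g (a ∷ y)

gridSum-distrib-+ : ∀ {k n} (f g : Point k n → ℕ) →
  gridSum (λ p → f p + g p) ≡ gridSum f + gridSum g
gridSum-distrib-+ {n = zero}  f g = refl
gridSum-distrib-+ {n = suc n} f g =
  trans (sum-cong-≗ λ a → gridSum-distrib-+ (λ y → f (a ∷ y)) (λ y → g (a ∷ y)))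
        (∑-distrib-+ (λ a → gridSum (λ y → f (a ∷ y))) (λ a → gridSum (λ y → g (a ∷ y))))

gridSum-mono-≤ : ∀ {k n} {f g : Point k n → ℕ} → (∀ p → f p ≤ g p) → gridSum f ≤ gridSum g
gridSum-mono-≤ {n = zero}  f≤g = f≤g []
gridSum-mono-≤ {n = suc n} f≤g = ∑-mono-≤ λ a → gridSum-mono-≤ λ y → f≤g (a ∷ y)

gridSum-mono-< : ∀ {k n} {f g : Point k n → ℕ} → (∀ p → f p ≤ g p) →
  ∀ x → f x < g x → gridSum f < gridSum g
gridSum-mono-< f≤g []      fx<gx = fx<gx
gridSum-mono-< f≤g (a ∷ y) fx<gx =
  ∑-mono-< (λ b → gridSum-mono-≤ λ z → f≤g (b ∷ z)) a (gridSum-mono-< (λ z → f≤g (a ∷ z)) y fx<gx)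

gridSum-zero : ∀ {k n} → gridSum {k} {n} (λ _ → 0) ≡ 0
gridSum-zero {n = zero}      = refl
gridSum-zero {k} {n = suc n} = begin
  ∑[ a < suc k ] gridSum {k} {n} (λ _ → 0)  ≡⟨ sum-cong-≗ {suc k} (λ _ → gridSum-zero {k} {n}) ⟩
  ∑[ a < suc k ] 0                         ≡⟨ sum-replicate-zero (suc k) ⟩
  0                                        ∎
  where open ≡-Reasoning

𝟙 : Bool → ℕ
𝟙 true  = 1
𝟙 false = 0

𝟙-mono-≤ : ∀ {a b} → (T a → T b) → 𝟙 a ≤ 𝟙 b
𝟙-mono-≤ {false}         _   = z≤n
𝟙-mono-≤ {true}  {true}  _   = ≤-refl
𝟙-mono-≤ {true}  {false} a⇒b = ⊥-elim (a⇒b _)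

𝟙-mono-< : ∀ {a b} → ¬ T a → T b → 𝟙 a < 𝟙 b
𝟙-mono-< {false} {true} _  _ = ≤-refl
𝟙-mono-< {true}         ¬a _ = ⊥-elim (¬a _)

𝟙-∖∪ : ∀ a l b → (T b → T l) → (T a → T l → T b) → 𝟙 ((l ∧ not b) ∨ a) + 𝟙 b ≡ 𝟙 l + 𝟙 a
𝟙-∖∪ true  true  true  _   _     = refl
𝟙-∖∪ true  true  false _   a∧l⇒b = ⊥-elim (a∧l⇒b _ _)
𝟙-∖∪ true  false true  b⇒l _     = ⊥-elim (b⇒l _)
𝟙-∖∪ true  false false _   _     = refl
𝟙-∖∪ false true  true  _   _     = refl
𝟙-∖∪ false true  false _   _     = refl
𝟙-∖∪ false false true  b⇒l _     = ⊥-elim (b⇒l _)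
𝟙-∖∪ false false false _   _     = refl

size : ∀ {k n} → (Point k n → Bool) → ℕ
size P = gridSum (λ p → 𝟙 (P p))

size-empty : ∀ {k n} {P : Point k n → Bool} → (∀ p → ¬ T (P p)) → size P ≡ 0
size-empty {k} {n} P-empty =
  n≤0⇒n≡0 (≤-trans (gridSum-mono-≤ (λ p → 𝟙-mono-≤ (P-empty p))) (≤-reflexive (gridSum-zero {k} {n})))

size-insert : ∀ {k n} {P Q : Point k n → Bool} {x} →
  (∀ {p} → T (P p) → T (Q p)) → ¬ T (P x) → T (Q x) → suc (size P) ≤ size Q
size-insert {x = x} P⊆Q x∉P x∈Q =
  gridSum-mono-< (λ p → 𝟙-mono-≤ P⊆Q) x (𝟙-mono-< x∉P x∈Q)

_∈?_ : ∀ {k n} (p : Point k n) (X : List (Point k n)) → Dec (p ∈ X)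
p ∈? X = Any.any? (≡-dec Fin._≟_ p) X

Unique⇒length≤size : ∀ {k n} (X : List (Point k n)) → Unique X →
  length X ≤ size (λ p → ⌊ p ∈? X ⌋)
Unique⇒length≤size []      []           = z≤n
Unique⇒length≤size (x ∷ X) (x∉X ∷ uniq) =
  ≤-trans (s≤s (Unique⇒length≤size X uniq))
          (size-insert {x = x} (λ p∈X → fromWitness (there (toWitness p∈X)))
                       (λ x∈X → All¬⇒¬Any x∉X (toWitness x∈X))
                       (fromWitness (here refl)))

module Layers {k n : ℕ} (L : ℕ → Point k n → Bool) where

  reach : ℕ → Point k n → Bool
  reach zero    = L zero
  reach (suc s) y = L (suc s) y ∧ ⌊ ∃? (λ z → T? (reach s z) ×-dec dist∞ z y ≤? 1) ⌋

  reach⊆L : ∀ s {y} → T (reach s y) → T (L s y)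
  reach⊆L zero    y∈A = y∈A
  reach⊆L (suc s) {y} y∈A = proj₁ (to (T-∧ {L (suc s) y}) y∈A)

  reach-pred : ∀ s {y} → T (reach (suc s) y) → ∃ λ z → T (reach s z) × dist∞ z y ≤ 1
  reach-pred s {y} y∈A = toWitness (proj₂ (to (T-∧ {L (suc s) y}) y∈A))

  reach-step : ∀ s {z y} → T (reach s z) → dist∞ z y ≤ 1 → T (L (suc s) y) → T (reach (suc s) y)
  reach-step s z∈A z~y y∈L = from T-∧ (y∈L , fromWitness (_ , z∈A , z~y))

  -- A walk from y down through the reach sets to layer 0, indexed by the number
  -- of steps taken and constant once it arrives.
  descent : ∀ s y → T (reach s y) → ℕ → Point k n
  descent s       y _   zero    = y
  descent zero    y _   (suc d) = y
  descent (suc s) y y∈A (suc d) = descent s z z∈A d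
    where z = proj₁ (reach-pred s y∈A); z∈A = proj₁ (proj₂ (reach-pred s y∈A))

  descent-∈ : ∀ s y y∈A d → T (reach (s ∸ d) (descent s y y∈A d))
  descent-∈ s       y y∈A zero    = y∈A
  descent-∈ zero    y y∈A (suc d) = y∈A
  descent-∈ (suc s) y y∈A (suc d) =
    descent-∈ s _ (proj₁ (proj₂ (reach-pred s y∈A))) d

  descent-step : ∀ s y y∈A d → dist∞ (descent s y y∈A (suc d)) (descent s y y∈A d) ≤ 1
  descent-step zero    y y∈A zero    = dist∞-self≤1 y
  descent-step zero    y y∈A (suc d) = dist∞-self≤1 y
  descent-step (suc s) y y∈A zero    = proj₂ (proj₂ (reach-pred s y∈A))
  descent-step (suc s) y y∈A (suc d) =
    descent-step s _ (proj₁ (proj₂ (reach-pred s y∈A))) d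

  ascent : ∀ s y → T (reach s y) → ℕ → Point k n
  ascent s y y∈A j = descent s y y∈A (s ∸ j)

  ascent-∈ : ∀ s y y∈A {j} → j ≤ s → T (reach j (ascent s y y∈A j))
  ascent-∈ s y y∈A {j} j≤s =
    subst (λ i → T (reach i (ascent s y y∈A j))) (m∸[m∸n]≡n j≤s) (descent-∈ s y y∈A (s ∸ j))

  ascent-steps : ∀ s y y∈A → UnitSteps (ascent s y y∈A)
  ascent-steps s y y∈A j with ∸-step s j
  ... | inj₁ same = subst (λ d → dist∞ (descent s y y∈A d) (ascent s y y∈A (suc j)) ≤ 1) (sym same)
                          (dist∞-self≤1 (ascent s y y∈A (suc j)))
  ... | inj₂ next = subst (λ d → dist∞ (descent s y y∈A d) (ascent s y y∈A (suc j)) ≤ 1) (sym next)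
                          (descent-step s y y∈A (s ∸ suc j))

  Z : ℕ → Point k n → Bool
  Z i y = (L (suc i) y ∧ not (reach (suc i) y)) ∨ reach i y

  Z∖reach⊆L : ∀ i {y} → T (Z i y) → reach i y ≡ false → T (L (suc i) y)
  Z∖reach⊆L i y∈Z y∉A with to T-∨ y∈Z
  ... | inj₁ h   = proj₁ (to T-∧ h)
  ... | inj₂ y∈A = ⊥-elim (subst T y∉A y∈A)

  -- A point of Z_i next to A_i lies in L_{i+1} ∩ N(A_i) = A_{i+1}, so it cannot be
  -- in L_{i+1} ∖ A_{i+1}.
  reach-closed-in-Z : ∀ i {u v} → T (reach i u) → dist∞ u v ≤ 1 → T (Z i v) → T (reach i v)
  reach-closed-in-Z i u∈A u~v v∈Z with to T-∨ v∈Z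
  ... | inj₂ v∈A = v∈A
  ... | inj₁ h with to T-∧ h
  ...   | v∈L , v∉A′ = ⊥-elim (subst T (to T-not-≡ v∉A′) (reach-step i u∈A u~v v∈L))

  reach-constant-on-copy : ∀ i {x} → (∀ s → T (Z i (x s))) → IsCopy x →
    ∀ s → reach i (x s) ≡ reach i (x zero)
  reach-constant-on-copy i {x} x∈Z isCopy = adjacent-equal⇒constant (reach i ∘ x) adjacent-equal
    where
    adjacent-equal : ∀ a → reach i (x (inject₁ a)) ≡ reach i (x (suc a))
    adjacent-equal a = T⇔T⇒≡ (λ h → reach-closed-in-Z i h x~x′ (x∈Z (suc a)))
                             (λ h → reach-closed-in-Z i h x′~x (x∈Z (inject₁ a)))
      where
      x~x′ = isCopy-adjacent {x = x} isCopy a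
      x′~x = subst (_≤ 1) (dist∞-sym (x (inject₁ a)) (x (suc a))) x~x′

  Z-copy⇒layer-copy : ∀ i → CopyIn (Z i) → CopyIn (L i) ⊎ CopyIn (L (suc i))
  Z-copy⇒layer-copy i (x , x∈Z , isCopy)
    with reach i (x zero) | reach-constant-on-copy i x∈Z isCopy
  ... | true  | constant = inj₁ (x , (λ s → reach⊆L i (subst T (sym (constant s)) _)) , isCopy)
  ... | false | constant = inj₂ (x , (λ s → Z∖reach⊆L i (x∈Z s) (constant s)) , isCopy)

  size-Z+size-reach : ∀ i → size (Z i) + size (reach (suc i)) ≡ size (L (suc i)) + size (reach i)
  size-Z+size-reach i = begin
    size (Z i) + size (reach (suc i))                          ≡⟨ gridSum-distrib-+ (𝟙 ∘ Z i) (𝟙 ∘ reach (suc i)) ⟨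
    gridSum (λ y → 𝟙 (Z i y) + 𝟙 (reach (suc i) y))           ≡⟨ gridSum-cong pointwise ⟩
    gridSum (λ y → 𝟙 (L (suc i) y) + 𝟙 (reach i y))           ≡⟨ gridSum-distrib-+ (𝟙 ∘ L (suc i)) (𝟙 ∘ reach i) ⟩
    size (L (suc i)) + size (reach i)                          ∎
    where
    open ≡-Reasoning
    pointwise : ∀ y → 𝟙 (Z i y) + 𝟙 (reach (suc i) y) ≡ 𝟙 (L (suc i) y) + 𝟙 (reach i y)
    pointwise y = 𝟙-∖∪ (reach i y) (L (suc i) y) (reach (suc i) y) (reach⊆L (suc i))
                       (λ y∈A y∈L → reach-step i y∈A (dist∞-self≤1 y) y∈L)

  ∑-size-Z : ∀ m → ∑[ i < m ] size (Z (toℕ i)) + size (reach m) ≡ ∑[ s < suc m ] size (L (toℕ s))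
  ∑-size-Z m = ∑-telescope m (size ∘ Z) (size ∘ L) (size ∘ reach) size-Z+size-reach

clamp : ∀ m → ℕ → Fin (suc m)
clamp m       zero    = zero
clamp zero    (suc s) = zero
clamp (suc m) (suc s) = suc (clamp m s)

clamp-toℕ : ∀ m (a : Fin (suc m)) → clamp m (toℕ a) ≡ a
clamp-toℕ m       zero    = refl
clamp-toℕ (suc m) (suc a) = cong suc (clamp-toℕ m a)

module Step {k n : ℕ} (P : Point k (suc n) → Bool) where

  -- Layers are indexed by ℕ so that reach can recurse on the index; indices
  -- beyond k are clamped and never used.
  L : ℕ → Point k n → Bool
  L s = layer P (clamp k s)

  open Layers L

  top-reached⇒copy : ∀ {y} → T (reach k y) → CopyIn P
  top-reached⇒copy {y} y∈A = stack w , w∈P , stack-isCopy w (ascent-steps k y y∈A)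
    where
    w = ascent k y y∈A
    w∈P : ∀ a → T (P (a ∷ w (toℕ a)))
    w∈P a = subst (λ b → T (P (b ∷ w (toℕ a)))) (clamp-toℕ k a)
                  (reach⊆L (toℕ a) (ascent-∈ k y y∈A (toℕ≤pred[n] a)))

  Z-copy⇒copy : ∀ i → CopyIn (Z i) → CopyIn P
  Z-copy⇒copy i = [ layer-copy⇒copy P (clamp k i) , layer-copy⇒copy P (clamp k (suc i)) ]′
                  ∘ Z-copy⇒layer-copy i

  size≡∑-size-Z : (∀ y → ¬ T (reach k y)) → size P ≡ ∑[ i < k ] size (Z (toℕ i))
  size≡∑-size-Z top-empty = begin
    size P                                         ≡⟨ sum-cong-≗ (λ a → cong (size ∘ layer P) (sym (clamp-toℕ k a))) ⟩
    ∑[ s < suc k ] size (L (toℕ s))                 ≡⟨ ∑-size-Z k ⟨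
    ∑[ i < k ] size (Z (toℕ i)) + size (reach k)   ≡⟨ cong (∑[ i < k ] size (Z (toℕ i)) +_) (size-empty top-empty) ⟩
    ∑[ i < k ] size (Z (toℕ i)) + 0                ≡⟨ +-identityʳ _ ⟩
    ∑[ i < k ] size (Z (toℕ i))                    ∎
    where open ≡-Reasoning

  copy-or-small-step : (∀ (Q : Point k n → Bool) → CopyIn Q ⊎ size Q ≤ k ^ n) →
    CopyIn P ⊎ size P ≤ k ^ suc n
  copy-or-small-step ih with ∃? (λ y → T? (reach k y)) | ∃-or-∀ {k} (λ i → ih (Z (toℕ i)))
  ... | yes (_ , y∈A) | _            = inj₁ (top-reached⇒copy y∈A)
  ... | no _          | inj₁ (i , c) = inj₁ (Z-copy⇒copy (toℕ i) c)
  ... | no top-empty  | inj₂ small   =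
    inj₂ (≤-trans (≤-reflexive (size≡∑-size-Z λ y y∈A → top-empty (y , y∈A))) (∑-≤-* small))

copy-or-small : ∀ {k} n (P : Point k n → Bool) → CopyIn P ⊎ size P ≤ k ^ n
copy-or-small zero    P = inj₂ (𝟙-mono-≤ {b = true} _)
copy-or-small (suc n) P = Step.copy-or-small-step P (copy-or-small n)

theorem2 : (k n : ℕ) → NonZero k → NonZero n →
    (X : List (Point k n)) → Unique X → k ^ n < length X →
    Σ (Fin (suc k) → Point k n) λ x →
    ((s : Fin (suc k)) → x s ∈ X) ×
    ((s t : Fin (suc k)) → dist∞ (x s) (x t) ≡ ∣ toℕ s - toℕ t ∣)
theorem2 k n _ _ X X-unique k^n<∣X∣ with copy-or-small n (λ p → ⌊ p ∈? X ⌋)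
... | inj₁ (x , x∈X , isCopy) = x , (λ s → toWitness (x∈X s)) , isCopy
... | inj₂ small = ⊥-elim (<⇒≱ k^n<∣X∣ (≤-trans (Unique⇒length≤size X X-unique) small))
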